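{- Let $R\in\mathbb{K}\langle\langle\mathbb{X}\rangle\rangle$ have zero constant term and $\langle R,X_0\rangle\neq0$. Then $R$ has a two-sided shift-plethystic inverse $R^{\langle-1\rangle}$, i.e. a series with $R\circ_s R^{\langle-1\rangle}=R^{\langle-1\rangle}\circ_s R=X_0$.
   Context: $\mathbb{X}=\{X_0,X_1,X_2,\dots\}$, $\mathbb{K}$ a field of characteristic zero, $\mathbb{K}\langle\langle\mathbb{X}\rangle\rangle$ the algebra of noncommutative formal power series. $\sigma$ is the continuous algebra endomorphism with $\sigma X_i=X_{i+1}$. For a series $R$ with zero constant term and a series $T=\sum_{\kappa}\langle T,X_\kappa\rangle X_\kappa$ (sum over all finite sequences $\kappa=(\kappa_1,\dots,\kappa_l)$ of nonnegative integers, $X_\kappa=X_{\kappa_1}\cdots X_{\kappa_l}$), the shift plethysm is $T\circ_s R=\sum_\kappa\langle T,X_\kappa\rangle(\sigma^{\kappa_1}R)(\sigma^{\kappa_2}R)\cdots(\sigma^{\kappa_l}R)$ (a convergent sum, the empty $\kappa$ giving $\langle T,1\rangle$). -}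

module Defs where

open import Level using (Level; _⊔_)
open import Algebra.Bundles using (CommutativeRing)
open import Data.Nat as ℕ using (ℕ; zero; suc; _∸_; _≤ᵇ_)
open import Data.Bool using (Bool; true; false; if_then_else_)
open import Data.List using (List; []; _∷_; map; concatMap; upTo; foldr; length)
open import Data.Product using (_×_; _,_; Σ)
open import Relation.Nullary using (¬_)

record IsField {c ℓ} (K : CommutativeRing c ℓ) : Set (c ⊔ ℓ) where
  open CommutativeRing K
  field
    nontrivial : ¬ (1# ≈ 0#)
    inverse    : ∀ x → ¬ (x ≈ 0#) → Σ Carrier (λ y → x * y ≈ 1#)

module _ {c ℓ} (K : CommutativeRing c ℓ) where
  open CommutativeRing K

  natK : ℕ → Carrier
  natK zero    = 0#
  natK (suc n) = 1# + natK n

  CharZero : Set ℓ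
  CharZero = ∀ n → ¬ (natK (suc n) ≈ 0#)

module Series {c ℓ} (K : CommutativeRing c ℓ) where
  open CommutativeRing K

  -- a word X_{κ1}...X_{κl} in the letters X_0, X_1, ... is the list (κ1,...,κl)
  Word : Set
  Word = List ℕ

  -- a noncommutative formal power series in X_0, X_1, ... : its coefficient map
  -- (⟨ S , X_w ⟩ = S w)
  Ser : Set c
  Ser = Word → Carrier

  _≈ˢ_ : Ser → Ser → Set ℓ
  S ≈ˢ T = ∀ w → S w ≈ T w

  X₀ : Ser
  X₀ (0 ∷ []) = 1#
  X₀ _           = 0#

  ZeroConst : Ser → Set ℓ
  ZeroConst S = S [] ≈ 0#

  -- σ^k : the continuous endomorphism X_i ↦ X_{i+k};
  -- ⟨ σ^k S , X_u ⟩ = ⟨ S , X_{u - k} ⟩ if every letter of u is ≥ k, else 0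
  allGe : ℕ → Word → Bool
  allGe k []      = true
  allGe k (a ∷ u) = if k ≤ᵇ a then allGe k u else false

  σ^ : ℕ → Ser → Ser
  σ^ k S u = if allGe k u then S (map (_∸ k) u) else 0#

  Σl : List Carrier → Carrier
  Σl = foldr _+_ 0#

  splits : Word → List (Word × Word)
  splits []      = ([] , []) ∷ []
  splits (a ∷ w) = ([] , a ∷ w) ∷ map (λ { (u , v) → (a ∷ u , v) }) (splits w)

  prodCoeff : List Ser → Word → Carrier
  prodCoeff []       []      = 1#
  prodCoeff []       (_ ∷ _) = 0#
  prodCoeff (S ∷ Ss) w       =
    Σl (map (λ { (u , v) → S u * prodCoeff Ss v }) (splits w))

  seqs : ℕ → ℕ → List Word
  seqs zero    m = [] ∷ []
  seqs (suc n) m = [] ∷ concatMap (λ k → map (k ∷_) (seqs n m)) (upTo (suc m))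

  maxLetter : Word → ℕ
  maxLetter = foldr ℕ._⊔_ 0

  -- shift plethysm  T ∘ₛ R = Σ_κ ⟨T,X_κ⟩ (σ^{κ1}R)⋯(σ^{κl}R), coefficientwise.
  -- For R with zero constant term, the coefficient at X_w of the κ-term
  -- vanishes unless length κ ≤ length w and every κᵢ ≤ max w, so the sum over
  -- κ below is exactly the (convergent) defining sum.
  _∘ₛ_ : Ser → Ser → Ser
  (T ∘ₛ R) w =
    Σl (map (λ κ → T κ * prodCoeff (map (λ k → σ^ k R) κ) w)
            (seqs (length w) (maxLetter w)))

module Submission where

-- Write ∂ a S for the left derivative of S by the letter X_a. When R has zero
-- constant term, composition obeys the chain rule
--   ∂ a (T ∘ₛ R) = Σ_{k ≤ a} σ^k (∂ (a ∸ k) R) · (∂ k T ∘ₛ R),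
-- whose right-hand side only involves T through its derivatives, i.e. at shorter
-- words. Induction on word length then shows that T ↦ T ∘ₛ R is multiplicative
-- and commutes with σ, and that ∘ₛ is associative with unit X₀. Read backwards,
-- the chain rule is a triangular system for the derivatives of an unknown P with
-- P ∘ₛ R = Y; its diagonal coefficient σ^a (∂ 0 R) has the invertible constant
-- term ⟨R, X₀⟩, so it can be solved recursively, giving a left inverse T of R.
-- T again has an invertible linear coefficient, hence a left inverse U, and
-- R = X₀ ∘ₛ R = (U ∘ₛ T) ∘ₛ R = U ∘ₛ X₀ = U, so T is a right inverse as well.

open import Defs
open import Algebra.Bundles using (CommutativeRing)
open import Data.Nat as ℕ using (ℕ; zero; suc; _∸_; _≤_; _<_; z≤n; s≤s; _≤ᵇ_)
  renaming (_+_ to _+ℕ_)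
import Data.Nat.Properties as ℕ
open import Data.List using (List; []; _∷_; map; length; _++_; upTo; applyUpTo; concatMap)
open import Data.List.Relation.Unary.Any using (Any; here; there)
open import Data.Bool using (true; false; if_then_else_)
open import Data.Product using (Σ; _×_; _,_)
open import Data.Sum using (_⊎_; inj₁; inj₂)
open import Function using (_∘_; id)
open import Function.Bundles using (Equivalence)
open import Data.Bool.Properties using (T-≡; ¬-not)
open import Relation.Nullary using (¬_; yes; no)
open import Relation.Binary.PropositionalEquality as ≡ using (_≡_)
import Relation.Binary.Reasoning.Setoid as SetoidReasoning
import Algebra.Properties.Group as GroupProperties
import Algebra.Properties.CommutativeSemigroup as CommSemigroupProperties

≤⇒≤ᵇ≡true : ∀ {m n} → m ≤ n → (m ≤ᵇ n) ≡ true
≤⇒≤ᵇ≡true m≤n = Equivalence.to T-≡ (ℕ.≤⇒≤ᵇ m≤n)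

>⇒≤ᵇ≡false : ∀ {m n} → n < m → (m ≤ᵇ n) ≡ false
>⇒≤ᵇ≡false {m} {n} n<m = ¬-not (λ m≤ᵇn → ℕ.<⇒≱ n<m (ℕ.≤ᵇ⇒≤ m n (Equivalence.from T-≡ m≤ᵇn)))

module Plethysm {c ℓ} (K : CommutativeRing c ℓ) where
  open CommutativeRing K hiding (zero)
  open Series K
  open SetoidReasoning setoid
  open GroupProperties +-group using (//-rightDividesˡ; ε⁻¹≈ε)
  open CommSemigroupProperties +-commutativeSemigroup using () renaming (interchange to +-interchange)
  open CommSemigroupProperties *-commutativeSemigroup using () renaming (x∙yz≈y∙xz to *-leftComm)

  -- Finite sums

  Σl-cong : {A : Set} {f g : A → Carrier} (xs : List A) → (∀ x → f x ≈ g x) →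
            Σl (map f xs) ≈ Σl (map g xs)
  Σl-cong []       f≈g = refl
  Σl-cong (x ∷ xs) f≈g = +-cong (f≈g x) (Σl-cong xs f≈g)

  Σl-zero : {A : Set} {f : A → Carrier} (xs : List A) → (∀ x → f x ≈ 0#) → Σl (map f xs) ≈ 0#
  Σl-zero []       f≈0 = refl
  Σl-zero (x ∷ xs) f≈0 = trans (+-cong (f≈0 x) (Σl-zero xs f≈0)) (+-identityˡ 0#)

  Σl-+ : {A : Set} {f g : A → Carrier} (xs : List A) →
         Σl (map (λ x → f x + g x) xs) ≈ Σl (map f xs) + Σl (map g xs)
  Σl-+ []                 = sym (+-identityˡ 0#)
  Σl-+ {f = f} {g} (x ∷ xs) = trans (+-congˡ (Σl-+ xs)) (+-interchange (f x) (g x) _ _)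

  Σl-*ˡ : {A : Set} {f : A → Carrier} (a : Carrier) (xs : List A) →
          a * Σl (map f xs) ≈ Σl (map (λ x → a * f x) xs)
  Σl-*ˡ a []       = zeroʳ a
  Σl-*ˡ a (x ∷ xs) = trans (distribˡ a _ _) (+-congˡ (Σl-*ˡ a xs))

  Σl-++ : {A : Set} {f : A → Carrier} (xs ys : List A) →
          Σl (map f (xs ++ ys)) ≈ Σl (map f xs) + Σl (map f ys)
  Σl-++ []       ys = sym (+-identityˡ _)
  Σl-++ (x ∷ xs) ys = trans (+-congˡ (Σl-++ xs ys)) (sym (+-assoc _ _ _))

  Σl-map : {A B : Set} {f : B → Carrier} {g : A → B} (xs : List A) →
           Σl (map f (map g xs)) ≈ Σl (map (f ∘ g) xs)
  Σl-map []       = refl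
  Σl-map (x ∷ xs) = +-congˡ (Σl-map xs)

  Σl-concatMap : {A B : Set} {f : B → Carrier} (g : A → List B) (xs : List A) →
                 Σl (map f (concatMap g xs)) ≈ Σl (map (λ x → Σl (map f (g x))) xs)
  Σl-concatMap g []       = refl
  Σl-concatMap g (x ∷ xs) = trans (Σl-++ (g x) (concatMap g xs)) (+-congˡ (Σl-concatMap g xs))

  Σl-comm : {A B : Set} (h : A → B → Carrier) (xs : List A) (ys : List B) →
            Σl (map (λ x → Σl (map (h x) ys)) xs) ≈ Σl (map (λ y → Σl (map (λ x → h x y) xs)) ys)
  Σl-comm h []       ys = sym (Σl-zero ys (λ _ → refl))
  Σl-comm h (x ∷ xs) ys = trans (+-congˡ (Σl-comm h xs ys)) (sym (Σl-+ ys))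

  ∑< : ℕ → (ℕ → Carrier) → Carrier
  ∑< zero    f = 0#
  ∑< (suc n) f = ∑< n f + f n

  ∑<-cong : ∀ n {f g : ℕ → Carrier} → (∀ k → k < n → f k ≈ g k) → ∑< n f ≈ ∑< n g
  ∑<-cong zero    f≈g = refl
  ∑<-cong (suc n) f≈g = +-cong (∑<-cong n (λ k k<n → f≈g k (ℕ.m<n⇒m<1+n k<n))) (f≈g n ℕ.≤-refl)

  ∑<-zero : ∀ n {f : ℕ → Carrier} → (∀ k → k < n → f k ≈ 0#) → ∑< n f ≈ 0#
  ∑<-zero zero    f≈0 = refl
  ∑<-zero (suc n) f≈0 =
    trans (+-cong (∑<-zero n (λ k k<n → f≈0 k (ℕ.m<n⇒m<1+n k<n))) (f≈0 n ℕ.≤-refl)) (+-identityˡ 0#)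

  ∑<-+ : ∀ n {f g : ℕ → Carrier} → ∑< n (λ k → f k + g k) ≈ ∑< n f + ∑< n g
  ∑<-+ zero            = sym (+-identityˡ 0#)
  ∑<-+ (suc n) {f} {g} = trans (+-congʳ (∑<-+ n)) (+-interchange _ _ (f n) (g n))

  ∑<-*ˡ : ∀ n (a : Carrier) {f : ℕ → Carrier} → a * ∑< n f ≈ ∑< n (λ k → a * f k)
  ∑<-*ˡ zero    a = zeroʳ a
  ∑<-*ˡ (suc n) a = trans (distribˡ a _ _) (+-congʳ (∑<-*ˡ n a))

  ∑<-suc : ∀ n (f : ℕ → Carrier) → ∑< (suc n) f ≈ f 0 + ∑< n (f ∘ suc)
  ∑<-suc zero    f = +-comm 0# (f 0)
  ∑<-suc (suc n) f = trans (+-congʳ (∑<-suc n f)) (+-assoc _ _ _)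

  ∑<-+ℕ : ∀ m n (f : ℕ → Carrier) → ∑< (m +ℕ n) f ≈ ∑< m f + ∑< n (λ i → f (m +ℕ i))
  ∑<-+ℕ m zero    f rewrite ℕ.+-identityʳ m = sym (+-identityʳ _)
  ∑<-+ℕ m (suc n) f rewrite ℕ.+-suc m n     = trans (+-congʳ (∑<-+ℕ m n f)) (+-assoc _ _ _)

  ∑<-vanishing-tail : ∀ {m n} (f : ℕ → Carrier) → m ≤ n → (∀ k → m ≤ k → k < n → f k ≈ 0#) →
                      ∑< n f ≈ ∑< m f
  ∑<-vanishing-tail {m} {n} f m≤n tail≈0 = begin
    ∑< n f                                        ≡⟨ ≡.cong (λ n → ∑< n f) (≡.sym (ℕ.m+[n∸m]≡n m≤n)) ⟩
    ∑< (m +ℕ (n ∸ m)) f                           ≈⟨ ∑<-+ℕ m (n ∸ m) f ⟩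
    ∑< m f + ∑< (n ∸ m) (λ i → f (m +ℕ i))       ≈⟨ +-congˡ (∑<-zero (n ∸ m) tail′) ⟩
    ∑< m f + 0#                                   ≈⟨ +-identityʳ _ ⟩
    ∑< m f                                        ∎
    where tail′ : ∀ i → i < n ∸ m → f (m +ℕ i) ≈ 0#
          tail′ i i<n∸m = tail≈0 (m +ℕ i) (ℕ.m≤m+n m i)
            (≡.subst (m +ℕ i <_) (ℕ.m+[n∸m]≡n m≤n) (ℕ.+-monoʳ-< m i<n∸m))

  ∑<-vanishing-head : ∀ m n (f : ℕ → Carrier) → (∀ k → k < m → f k ≈ 0#) →
                      ∑< (m +ℕ n) f ≈ ∑< n (λ i → f (m +ℕ i))
  ∑<-vanishing-head m n f head≈0 =
    trans (∑<-+ℕ m n f) (trans (+-congʳ (∑<-zero m head≈0)) (+-identityˡ _))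

  Σl-upTo : (f : ℕ → Carrier) (n : ℕ) → Σl (map f (upTo n)) ≈ ∑< n f
  Σl-upTo f n = applyUpTo-sum id n
    where applyUpTo-sum : (h : ℕ → ℕ) (n : ℕ) → Σl (map f (applyUpTo h n)) ≈ ∑< n (f ∘ h)
          applyUpTo-sum h zero    = refl
          applyUpTo-sum h (suc n) =
            trans (+-congˡ (applyUpTo-sum (h ∘ suc) n)) (sym (∑<-suc n (f ∘ h)))

  ∑<-triangle : ∀ N (f : ℕ → ℕ → Carrier) →
                ∑< N (λ k → ∑< (suc k) (f k)) ≈ ∑< N (λ j → ∑< (N ∸ j) (λ i → f (j +ℕ i) j))
  ∑<-triangle zero    f = refl
  ∑<-triangle (suc N) f = begin
    ∑< N (λ k → ∑< (suc k) (f k)) + ∑< (suc N) (f N)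
      ≈⟨ +-congʳ (∑<-triangle N f) ⟩
    ∑< N (λ j → ∑< (N ∸ j) (λ i → f (j +ℕ i) j)) + ∑< (suc N) (f N)
      ≈⟨ +-congʳ (sym (trans (+-congˡ (reflexive (≡.cong (λ n → ∑< n (row N)) (ℕ.n∸n≡0 N)))) (+-identityʳ _))) ⟩
    ∑< (suc N) (λ j → ∑< (N ∸ j) (λ i → f (j +ℕ i) j)) + ∑< (suc N) (f N)
      ≈⟨ sym (∑<-+ (suc N)) ⟩
    ∑< (suc N) (λ j → ∑< (N ∸ j) (λ i → f (j +ℕ i) j) + f N j)
      ≈⟨ ∑<-cong (suc N) extend ⟩
    ∑< (suc N) (λ j → ∑< (suc N ∸ j) (λ i → f (j +ℕ i) j))  ∎
    where
      row : ℕ → ℕ → Carrier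
      row j i = f (j +ℕ i) j
      extend : ∀ j → j < suc N →
               ∑< (N ∸ j) (λ i → f (j +ℕ i) j) + f N j ≈ ∑< (suc N ∸ j) (λ i → f (j +ℕ i) j)
      extend j (s≤s j≤N) = sym (trans (reflexive (≡.cong (λ n → ∑< n (row j)) (ℕ.+-∸-assoc 1 j≤N)))
                                      (+-congˡ (reflexive (≡.cong (λ k → f k j) (ℕ.m+[n∸m]≡n j≤N)))))

  -- Series as a ring

  infixl 6 _+ˢ_ _-ˢ_
  infixl 7 _*ˢ_ _·ˢ_
  infix 4 _≈[_]_

  _≈[_]_ : Ser → ℕ → Ser → Set ℓ
  A ≈[ n ] B = ∀ w → length w ≤ n → A w ≈ B w

  ≈ˢ⇒≈[] : ∀ {n A B} → A ≈ˢ B → A ≈[ n ] B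
  ≈ˢ⇒≈[] A≈B w _ = A≈B w

  ≈[]⇒≈ˢ : ∀ {A B} → (∀ n → A ≈[ n ] B) → A ≈ˢ B
  ≈[]⇒≈ˢ A≈B w = A≈B (length w) w ℕ.≤-refl

  ≈[]-by-≈ˢ : ∀ {n A A′ B B′} → A ≈ˢ A′ → A′ ≈[ n ] B′ → B ≈ˢ B′ → A ≈[ n ] B
  ≈[]-by-≈ˢ A≈A′ A′≈B′ B≈B′ w w≤n = trans (A≈A′ w) (trans (A′≈B′ w w≤n) (sym (B≈B′ w)))

  ≈ˢ-trans : ∀ {A B C} → A ≈ˢ B → B ≈ˢ C → A ≈ˢ C
  ≈ˢ-trans A≈B B≈C w = trans (A≈B w) (B≈C w)

  ≈ˢ-sym : ∀ {A B} → A ≈ˢ B → B ≈ˢ A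
  ≈ˢ-sym A≈B w = sym (A≈B w)

  0ˢ 1ˢ : Ser
  0ˢ _       = 0#
  1ˢ []      = 1#
  1ˢ (_ ∷ _) = 0#

  _+ˢ_ _-ˢ_ : Ser → Ser → Ser
  (A +ˢ B) w = A w + B w
  (A -ˢ B) w = A w - B w

  _·ˢ_ : Carrier → Ser → Ser
  (a ·ˢ A) w = a * A w

  _*ˢ_ : Ser → Ser → Ser
  (A *ˢ B) w = Σl (map (λ { (u , v) → A u * B v }) (splits w))

  ∂ : ℕ → Ser → Ser
  ∂ a A w = A (a ∷ w)

  Σˢ : ℕ → (ℕ → Ser) → Ser
  Σˢ n F w = ∑< n (λ k → F k w)

  *ˢ-[] : ∀ A B → (A *ˢ B) [] ≈ A [] * B []
  *ˢ-[] A B = +-identityʳ _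

  *ˢ-∷ : ∀ A B a w → (A *ˢ B) (a ∷ w) ≈ A [] * B (a ∷ w) + (∂ a A *ˢ B) w
  *ˢ-∷ A B a w = +-congˡ (Σl-map (splits w))

  ∂-*ˢ : ∀ a A B → ∂ a (A *ˢ B) ≈ˢ (A [] ·ˢ ∂ a B +ˢ ∂ a A *ˢ B)
  ∂-*ˢ a A B = *ˢ-∷ A B a

  *ˢ-cong : ∀ {A A′ B B′} → A ≈ˢ A′ → B ≈ˢ B′ → (A *ˢ B) ≈ˢ (A′ *ˢ B′)
  *ˢ-cong A≈ B≈ w = Σl-cong (splits w) (λ (u , v) → *-cong (A≈ u) (B≈ v))

  *ˢ-congˡ : ∀ {A B B′} → B ≈ˢ B′ → (A *ˢ B) ≈ˢ (A *ˢ B′)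
  *ˢ-congˡ = *ˢ-cong (λ _ → refl)

  *ˢ-congʳ : ∀ {A A′ B} → A ≈ˢ A′ → (A *ˢ B) ≈ˢ (A′ *ˢ B)
  *ˢ-congʳ A≈ = *ˢ-cong A≈ (λ _ → refl)

  *ˢ-cong≤ : ∀ n {A A′ B B′} → A ≈[ n ] A′ → B ≈[ n ] B′ → A *ˢ B ≈[ n ] A′ *ˢ B′
  *ˢ-cong≤ n {A} {A′} {B} {B′} A≈ B≈ [] _ = begin
    (A *ˢ B) []      ≈⟨ *ˢ-[] A B ⟩
    A [] * B []      ≈⟨ *-cong (A≈ [] z≤n) (B≈ [] z≤n) ⟩
    A′ [] * B′ []    ≈⟨ sym (*ˢ-[] A′ B′) ⟩
    (A′ *ˢ B′) []    ∎
  *ˢ-cong≤ (suc n) {A} {A′} {B} {B′} A≈ B≈ (a ∷ w) (s≤s w≤n) = begin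
    (A *ˢ B) (a ∷ w)                     ≈⟨ *ˢ-∷ A B a w ⟩
    A [] * B (a ∷ w) + (∂ a A *ˢ B) w    ≈⟨ +-cong (*-cong (A≈ [] z≤n) (B≈ (a ∷ w) (s≤s w≤n)))
                                                   (*ˢ-cong≤ n ∂A≈ (λ v v≤n → B≈ v (ℕ.m≤n⇒m≤1+n v≤n)) w w≤n) ⟩
    A′ [] * B′ (a ∷ w) + (∂ a A′ *ˢ B′) w ≈⟨ sym (*ˢ-∷ A′ B′ a w) ⟩
    (A′ *ˢ B′) (a ∷ w)                   ∎
    where ∂A≈ : ∂ a A ≈[ n ] ∂ a A′
          ∂A≈ v v≤n = A≈ (a ∷ v) (s≤s v≤n)

  Σˢ-cong≤ : ∀ n m {F G : ℕ → Ser} → (∀ k → k < m → F k ≈[ n ] G k) → Σˢ m F ≈[ n ] Σˢ m G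
  Σˢ-cong≤ n m F≈G w w≤n = ∑<-cong m (λ k k<m → F≈G k k<m w w≤n)

  Σˢ-cong : ∀ m {F G : ℕ → Ser} → (∀ k → k < m → F k ≈ˢ G k) → Σˢ m F ≈ˢ Σˢ m G
  Σˢ-cong m F≈G w = ∑<-cong m (λ k k<m → F≈G k k<m w)

  Σˢ-zero : ∀ m (F : ℕ → Ser) → (∀ k → k < m → F k ≈ˢ 0ˢ) → Σˢ m F ≈ˢ 0ˢ
  Σˢ-zero m F F≈0 w = ∑<-zero m (λ k k<m → F≈0 k k<m w)

  Σˢ-+ : ∀ m (F G : ℕ → Ser) → Σˢ m (λ k → F k +ˢ G k) ≈ˢ (Σˢ m F +ˢ Σˢ m G)
  Σˢ-+ m F G w = ∑<-+ m

  Σˢ-·ˢ : ∀ m a (F : ℕ → Ser) → Σˢ m (λ k → a ·ˢ F k) ≈ˢ (a ·ˢ Σˢ m F)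
  Σˢ-·ˢ m a F w = sym (∑<-*ˡ m a)

  *ˢ-distribʳ : ∀ A B C → ((A +ˢ B) *ˢ C) ≈ˢ (A *ˢ C +ˢ B *ˢ C)
  *ˢ-distribʳ A B C w =
    trans (Σl-cong (splits w) (λ (u , v) → distribʳ (C v) (A u) (B u))) (Σl-+ (splits w))

  *ˢ-distribˡ : ∀ A B C → (A *ˢ (B +ˢ C)) ≈ˢ (A *ˢ B +ˢ A *ˢ C)
  *ˢ-distribˡ A B C w =
    trans (Σl-cong (splits w) (λ (u , v) → distribˡ (A u) (B v) (C v))) (Σl-+ (splits w))

  *ˢ-zeroˡ : ∀ A → (0ˢ *ˢ A) ≈ˢ 0ˢ
  *ˢ-zeroˡ A w = Σl-zero (splits w) (λ (u , v) → zeroˡ (A v))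

  *ˢ-zeroʳ : ∀ A → (A *ˢ 0ˢ) ≈ˢ 0ˢ
  *ˢ-zeroʳ A w = Σl-zero (splits w) (λ (u , v) → zeroʳ (A u))

  *ˢ-·ˢˡ : ∀ a A B → ((a ·ˢ A) *ˢ B) ≈ˢ (a ·ˢ (A *ˢ B))
  *ˢ-·ˢˡ a A B w =
    trans (Σl-cong (splits w) (λ (u , v) → *-assoc a (A u) (B v))) (sym (Σl-*ˡ a (splits w)))

  *ˢ-·ˢʳ : ∀ a A B → (A *ˢ (a ·ˢ B)) ≈ˢ (a ·ˢ (A *ˢ B))
  *ˢ-·ˢʳ a A B w =
    trans (Σl-cong (splits w) (λ (u , v) → *-leftComm (A u) a (B v))) (sym (Σl-*ˡ a (splits w)))

  *ˢ-Σˢʳ : ∀ n (F : ℕ → Ser) C → (Σˢ n F *ˢ C) ≈ˢ (Σˢ n (λ k → F k *ˢ C))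
  *ˢ-Σˢʳ zero    F C = *ˢ-zeroˡ C
  *ˢ-Σˢʳ (suc n) F C w = trans (*ˢ-distribʳ (Σˢ n F) (F n) C w) (+-congʳ (*ˢ-Σˢʳ n F C w))

  *ˢ-Σˢˡ : ∀ n (F : ℕ → Ser) C → (C *ˢ Σˢ n F) ≈ˢ (Σˢ n (λ k → C *ˢ F k))
  *ˢ-Σˢˡ zero    F C = *ˢ-zeroʳ C
  *ˢ-Σˢˡ (suc n) F C w = trans (*ˢ-distribˡ C (Σˢ n F) (F n) w) (+-congʳ (*ˢ-Σˢˡ n F C w))

  *ˢ-identityˡ : ∀ A → (1ˢ *ˢ A) ≈ˢ A
  *ˢ-identityˡ A []      = trans (*ˢ-[] 1ˢ A) (*-identityˡ _)
  *ˢ-identityˡ A (a ∷ w) =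
    trans (*ˢ-∷ 1ˢ A a w) (trans (+-cong (*-identityˡ _) (*ˢ-zeroˡ A w)) (+-identityʳ _))

  *ˢ-identityʳ : ∀ A → (A *ˢ 1ˢ) ≈ˢ A
  *ˢ-identityʳ A []      = trans (*ˢ-[] A 1ˢ) (*-identityʳ _)
  *ˢ-identityʳ A (a ∷ w) =
    trans (*ˢ-∷ A 1ˢ a w) (trans (+-cong (zeroʳ _) (*ˢ-identityʳ (∂ a A) w)) (+-identityˡ _))

  *ˢ-assoc : ∀ A B C → ((A *ˢ B) *ˢ C) ≈ˢ (A *ˢ (B *ˢ C))
  *ˢ-assoc A B C [] = begin
    ((A *ˢ B) *ˢ C) []     ≈⟨ *ˢ-[] (A *ˢ B) C ⟩
    (A *ˢ B) [] * C []     ≈⟨ *-congʳ (*ˢ-[] A B) ⟩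
    (A [] * B []) * C []   ≈⟨ *-assoc _ _ _ ⟩
    A [] * (B [] * C [])   ≈⟨ *-congˡ (sym (*ˢ-[] B C)) ⟩
    A [] * (B *ˢ C) []     ≈⟨ sym (*ˢ-[] A (B *ˢ C)) ⟩
    (A *ˢ (B *ˢ C)) []     ∎
  *ˢ-assoc A B C (a ∷ w) = begin
    ((A *ˢ B) *ˢ C) (a ∷ w)
      ≈⟨ *ˢ-∷ (A *ˢ B) C a w ⟩
    (A *ˢ B) [] * C (a ∷ w) + (∂ a (A *ˢ B) *ˢ C) w
      ≈⟨ +-cong (*-congʳ (*ˢ-[] A B)) (*ˢ-congʳ (∂-*ˢ a A B) w) ⟩
    (A [] * B []) * C (a ∷ w) + ((A [] ·ˢ ∂ a B +ˢ ∂ a A *ˢ B) *ˢ C) w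
      ≈⟨ +-congˡ (*ˢ-distribʳ (A [] ·ˢ ∂ a B) (∂ a A *ˢ B) C w) ⟩
    (A [] * B []) * C (a ∷ w) + (((A [] ·ˢ ∂ a B) *ˢ C) w + ((∂ a A *ˢ B) *ˢ C) w)
      ≈⟨ +-congˡ (+-cong (*ˢ-·ˢˡ (A []) (∂ a B) C w) (*ˢ-assoc (∂ a A) B C w)) ⟩
    (A [] * B []) * C (a ∷ w) + (A [] * (∂ a B *ˢ C) w + (∂ a A *ˢ (B *ˢ C)) w)
      ≈⟨ sym (+-assoc _ _ _) ⟩
    ((A [] * B []) * C (a ∷ w) + A [] * (∂ a B *ˢ C) w) + (∂ a A *ˢ (B *ˢ C)) w
      ≈⟨ +-congʳ (trans (+-congʳ (*-assoc _ _ _)) (sym (distribˡ (A []) _ _))) ⟩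
    A [] * (B [] * C (a ∷ w) + (∂ a B *ˢ C) w) + (∂ a A *ˢ (B *ˢ C)) w
      ≈⟨ +-congʳ (*-congˡ (sym (*ˢ-∷ B C a w))) ⟩
    A [] * (B *ˢ C) (a ∷ w) + (∂ a A *ˢ (B *ˢ C)) w
      ≈⟨ sym (*ˢ-∷ A (B *ˢ C) a w) ⟩
    (A *ˢ (B *ˢ C)) (a ∷ w)  ∎

  -- The shift σ

  σ^-cong : ∀ j {A A′} → A ≈ˢ A′ → σ^ j A ≈ˢ σ^ j A′
  σ^-cong j A≈ w with allGe j w
  ... | true  = A≈ _
  ... | false = refl

  ∂-σ^-≥ : ∀ j a A → j ≤ a → ∂ a (σ^ j A) ≈ˢ σ^ j (∂ (a ∸ j) A)
  ∂-σ^-≥ j a A j≤a w rewrite ≤⇒≤ᵇ≡true j≤a = refl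

  ∂-σ^-< : ∀ j a A → a < j → ∂ a (σ^ j A) ≈ˢ 0ˢ
  ∂-σ^-< j a A a<j w rewrite >⇒≤ᵇ≡false a<j = refl

  σ^-+ˢ : ∀ j A B → σ^ j (A +ˢ B) ≈ˢ (σ^ j A +ˢ σ^ j B)
  σ^-+ˢ j A B w with allGe j w
  ... | true  = refl
  ... | false = sym (+-identityˡ 0#)

  σ^-·ˢ : ∀ j a A → σ^ j (a ·ˢ A) ≈ˢ (a ·ˢ σ^ j A)
  σ^-·ˢ j a A w with allGe j w
  ... | true  = refl
  ... | false = sym (zeroʳ a)

  σ^-0ˢ : ∀ j → σ^ j 0ˢ ≈ˢ 0ˢ
  σ^-0ˢ j w with allGe j w
  ... | true  = refl
  ... | false = refl

  σ^-1ˢ : ∀ j → σ^ j 1ˢ ≈ˢ 1ˢ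
  σ^-1ˢ j []      = refl
  σ^-1ˢ j (a ∷ w) with allGe j (a ∷ w)
  ... | true  = refl
  ... | false = refl

  σ^-Σˢ : ∀ j n F → σ^ j (Σˢ n F) ≈ˢ Σˢ n (λ k → σ^ j (F k))
  σ^-Σˢ j zero    F = σ^-0ˢ j
  σ^-Σˢ j (suc n) F w = trans (σ^-+ˢ j (Σˢ n F) (F n) w) (+-congʳ (σ^-Σˢ j n F w))

  σ^-identity : ∀ A → σ^ 0 A ≈ˢ A
  σ^-identity A []      = refl
  σ^-identity A (a ∷ w) = σ^-identity (∂ a A) w

  σ^-*ˢ : ∀ j A B → σ^ j (A *ˢ B) ≈ˢ (σ^ j A *ˢ σ^ j B)
  σ^-*ˢ j A B [] = trans (*ˢ-[] A B) (sym (*ˢ-[] (σ^ j A) (σ^ j B)))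
  σ^-*ˢ j A B (a ∷ w) with j ℕ.≤? a
  ... | yes j≤a = begin
    σ^ j (A *ˢ B) (a ∷ w)
      ≈⟨ ∂-σ^-≥ j a (A *ˢ B) j≤a w ⟩
    σ^ j (∂ (a ∸ j) (A *ˢ B)) w
      ≈⟨ σ^-cong j (∂-*ˢ (a ∸ j) A B) w ⟩
    σ^ j (A [] ·ˢ ∂ (a ∸ j) B +ˢ ∂ (a ∸ j) A *ˢ B) w
      ≈⟨ σ^-+ˢ j (A [] ·ˢ ∂ (a ∸ j) B) (∂ (a ∸ j) A *ˢ B) w ⟩
    σ^ j (A [] ·ˢ ∂ (a ∸ j) B) w + σ^ j (∂ (a ∸ j) A *ˢ B) w
      ≈⟨ +-cong (σ^-·ˢ j (A []) (∂ (a ∸ j) B) w) (σ^-*ˢ j (∂ (a ∸ j) A) B w) ⟩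
    A [] * σ^ j (∂ (a ∸ j) B) w + (σ^ j (∂ (a ∸ j) A) *ˢ σ^ j B) w
      ≈⟨ sym (+-cong (*-congˡ (∂-σ^-≥ j a B j≤a w)) (*ˢ-congʳ (∂-σ^-≥ j a A j≤a) w)) ⟩
    A [] * σ^ j B (a ∷ w) + (∂ a (σ^ j A) *ˢ σ^ j B) w
      ≈⟨ sym (*ˢ-∷ (σ^ j A) (σ^ j B) a w) ⟩
    (σ^ j A *ˢ σ^ j B) (a ∷ w)  ∎
  ... | no j≰a = begin
    σ^ j (A *ˢ B) (a ∷ w)                                ≈⟨ ∂-σ^-< j a (A *ˢ B) a<j w ⟩
    0#                                                   ≈⟨ sym (+-identityʳ 0#) ⟩
    0# + 0#                                              ≈⟨ sym (+-cong first second) ⟩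
    A [] * σ^ j B (a ∷ w) + (∂ a (σ^ j A) *ˢ σ^ j B) w   ≈⟨ sym (*ˢ-∷ (σ^ j A) (σ^ j B) a w) ⟩
    (σ^ j A *ˢ σ^ j B) (a ∷ w)                           ∎
    where
      a<j = ℕ.≰⇒> j≰a
      first : A [] * σ^ j B (a ∷ w) ≈ 0#
      first = trans (*-congˡ (∂-σ^-< j a B a<j w)) (zeroʳ _)
      second : (∂ a (σ^ j A) *ˢ σ^ j B) w ≈ 0#
      second = trans (*ˢ-congʳ (∂-σ^-< j a A a<j) w) (*ˢ-zeroˡ (σ^ j B) w)

  σ^-σ^ : ∀ i j A → σ^ i (σ^ j A) ≈ˢ σ^ (i +ℕ j) A
  σ^-σ^ i j A [] = refl
  σ^-σ^ i j A (a ∷ w) with i ℕ.≤? a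
  ... | no i≰a = trans (∂-σ^-< i a (σ^ j A) a<i w) (sym (∂-σ^-< (i +ℕ j) a A a<i+j w))
    where a<i = ℕ.≰⇒> i≰a
          a<i+j = ℕ.<-≤-trans a<i (ℕ.m≤m+n i j)
  ... | yes i≤a with j ℕ.≤? (a ∸ i)
  ...   | yes j≤a∸i = begin
    σ^ i (σ^ j A) (a ∷ w)              ≈⟨ ∂-σ^-≥ i a (σ^ j A) i≤a w ⟩
    σ^ i (∂ (a ∸ i) (σ^ j A)) w        ≈⟨ σ^-cong i (∂-σ^-≥ j (a ∸ i) A j≤a∸i) w ⟩
    σ^ i (σ^ j (∂ (a ∸ i ∸ j) A)) w    ≈⟨ σ^-σ^ i j (∂ (a ∸ i ∸ j) A) w ⟩
    σ^ (i +ℕ j) (∂ (a ∸ i ∸ j) A) w    ≡⟨ ≡.cong (λ b → σ^ (i +ℕ j) (∂ b A) w) (ℕ.∸-+-assoc a i j) ⟩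
    σ^ (i +ℕ j) (∂ (a ∸ (i +ℕ j)) A) w ≈⟨ sym (∂-σ^-≥ (i +ℕ j) a A i+j≤a w) ⟩
    σ^ (i +ℕ j) A (a ∷ w)              ∎
    where i+j≤a : i +ℕ j ≤ a
          i+j≤a = ≡.subst (i +ℕ j ≤_) (ℕ.m+[n∸m]≡n i≤a) (ℕ.+-monoʳ-≤ i j≤a∸i)
  ...   | no j≰a∸i = begin
    σ^ i (σ^ j A) (a ∷ w)              ≈⟨ ∂-σ^-≥ i a (σ^ j A) i≤a w ⟩
    σ^ i (∂ (a ∸ i) (σ^ j A)) w        ≈⟨ σ^-cong i (∂-σ^-< j (a ∸ i) A (ℕ.≰⇒> j≰a∸i)) w ⟩
    σ^ i 0ˢ w                          ≈⟨ σ^-0ˢ i w ⟩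
    0#                                 ≈⟨ sym (∂-σ^-< (i +ℕ j) a A a<i+j w) ⟩
    σ^ (i +ℕ j) A (a ∷ w)              ∎
    where a<i+j : a < i +ℕ j
          a<i+j = ≡.subst (_< i +ℕ j) (ℕ.m+[n∸m]≡n i≤a) (ℕ.+-monoʳ-< i (ℕ.≰⇒> j≰a∸i))

  -- The chain rule

  σProduct : Ser → Word → Ser
  σProduct R κ = prodCoeff (map (λ k → σ^ k R) κ)

  OrderAtLeast : ℕ → Ser → Set ℓ
  OrderAtLeast n A = ∀ v → length v < n → A v ≈ 0#

  *ˢ-orderʳ : ∀ {n B} → OrderAtLeast n B → ∀ A → OrderAtLeast n (A *ˢ B)
  *ˢ-orderʳ {n} {B} B-ord A [] 0<n = trans (*ˢ-[] A B) (trans (*-congˡ (B-ord [] 0<n)) (zeroʳ _))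
  *ˢ-orderʳ {n} {B} B-ord A (a ∷ v) |av|<n =
    trans (*ˢ-∷ A B a v)
          (trans (+-cong (trans (*-congˡ (B-ord (a ∷ v) |av|<n)) (zeroʳ _))
                         (*ˢ-orderʳ B-ord (∂ a A) v (ℕ.<-trans (ℕ.n<1+n _) |av|<n)))
                 (+-identityʳ 0#))

  *ˢ-order-suc : ∀ {n A B} → ZeroConst A → OrderAtLeast n B → OrderAtLeast (suc n) (A *ˢ B)
  *ˢ-order-suc {n} {A} {B} A₀ B-ord [] _ = trans (*ˢ-[] A B) (trans (*-congʳ A₀) (zeroˡ _))
  *ˢ-order-suc {n} {A} {B} A₀ B-ord (a ∷ v) (s≤s |v|<n) =
    trans (*ˢ-∷ A B a v)
          (trans (+-cong (trans (*-congʳ A₀) (zeroˡ _)) (*ˢ-orderʳ B-ord (∂ a A) v |v|<n))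
                 (+-identityʳ 0#))

  σProduct-order : ∀ R → ZeroConst R → ∀ κ → OrderAtLeast (length κ) (σProduct R κ)
  σProduct-order R R₀ []      v ()
  σProduct-order R R₀ (k ∷ κ) = *ˢ-order-suc {A = σ^ k R} R₀ (σProduct-order R R₀ κ)

  VanishesBelow : ℕ → Ser → Set ℓ
  VanishesBelow b A = ∀ u → maxLetter u ≤ b → A u ≈ 0#

  *ˢ-vanishesBelowˡ : ∀ {b A} → VanishesBelow b A → ∀ B → VanishesBelow b (A *ˢ B)
  *ˢ-vanishesBelowˡ {b} {A} A-van B [] _ = trans (*ˢ-[] A B) (trans (*-congʳ (A-van [] z≤n)) (zeroˡ _))
  *ˢ-vanishesBelowˡ {b} {A} A-van B (a ∷ v) av≤b =
    trans (*ˢ-∷ A B a v)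
          (trans (+-cong (trans (*-congʳ (A-van [] z≤n)) (zeroˡ _))
                         (*ˢ-vanishesBelowˡ ∂A-van B v (ℕ.m⊔n≤o⇒n≤o a _ av≤b)))
                 (+-identityʳ 0#))
    where ∂A-van : VanishesBelow b (∂ a A)
          ∂A-van u u≤b = A-van (a ∷ u) (ℕ.⊔-lub (ℕ.m⊔n≤o⇒m≤o a _ av≤b) u≤b)

  *ˢ-vanishesBelowʳ : ∀ {b B} → VanishesBelow b B → ∀ A → VanishesBelow b (A *ˢ B)
  *ˢ-vanishesBelowʳ {b} {B} B-van A [] _ = trans (*ˢ-[] A B) (trans (*-congˡ (B-van [] z≤n)) (zeroʳ _))
  *ˢ-vanishesBelowʳ {b} {B} B-van A (a ∷ v) av≤b =
    trans (*ˢ-∷ A B a v)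
          (trans (+-cong (trans (*-congˡ (B-van (a ∷ v) av≤b)) (zeroʳ _))
                         (*ˢ-vanishesBelowʳ B-van (∂ a A) v (ℕ.m⊔n≤o⇒n≤o a _ av≤b)))
                 (+-identityʳ 0#))

  σ^-vanishesBelow : ∀ R → ZeroConst R → ∀ {b k} → b < k → VanishesBelow b (σ^ k R)
  σ^-vanishesBelow R R₀ b<k []      _    = R₀
  σ^-vanishesBelow R R₀ {b} {k} b<k (x ∷ u) xu≤b =
    ∂-σ^-< k x R (ℕ.≤-<-trans (ℕ.m⊔n≤o⇒m≤o x _ xu≤b) b<k) u

  σProduct-vanishesBelow : ∀ R → ZeroConst R → ∀ {b} κ → Any (b <_) κ → VanishesBelow b (σProduct R κ)
  σProduct-vanishesBelow R R₀ (k ∷ κ) (here b<k) =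
    *ˢ-vanishesBelowˡ (σ^-vanishesBelow R R₀ b<k) (σProduct R κ)
  σProduct-vanishesBelow R R₀ (k ∷ κ) (there b<κ) =
    *ˢ-vanishesBelowʳ (σProduct-vanishesBelow R R₀ κ b<κ) (σ^ k R)

  boxΣ : ℕ → ℕ → (Word → Carrier) → Carrier
  boxΣ n m f = Σl (map f (seqs n m))

  SupportedIn : ℕ → ℕ → (Word → Carrier) → Set ℓ
  SupportedIn n m f = ∀ κ → n < length κ ⊎ Any (m <_) κ → f κ ≈ 0#

  boxΣ-suc : ∀ n m f → boxΣ (suc n) m f ≈ f [] + ∑< (suc m) (λ k → boxΣ n m (λ κ → f (k ∷ κ)))
  boxΣ-suc n m f = +-congˡ (begin
    Σl (map f (concatMap (λ k → map (k ∷_) (seqs n m)) (upTo (suc m))))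
      ≈⟨ Σl-concatMap (λ k → map (k ∷_) (seqs n m)) (upTo (suc m)) ⟩
    Σl (map (λ k → Σl (map f (map (k ∷_) (seqs n m)))) (upTo (suc m)))
      ≈⟨ Σl-cong (upTo (suc m)) (λ k → Σl-map (seqs n m)) ⟩
    Σl (map (λ k → boxΣ n m (λ κ → f (k ∷ κ))) (upTo (suc m)))
      ≈⟨ Σl-upTo _ (suc m) ⟩
    ∑< (suc m) (λ k → boxΣ n m (λ κ → f (k ∷ κ)))  ∎)

  boxΣ-enlarge : ∀ {n n′ m m′} f → SupportedIn n m f → n ≤ n′ → m ≤ m′ → boxΣ n′ m′ f ≈ boxΣ n m f
  boxΣ-enlarge {zero} {zero} f supp _ _ = refl
  boxΣ-enlarge {zero} {suc n′} {m} {m′} f supp _ _ = begin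
    boxΣ (suc n′) m′ f                            ≈⟨ boxΣ-suc n′ m′ f ⟩
    f [] + ∑< (suc m′) (λ k → boxΣ n′ m′ (f ∘ (k ∷_)))
      ≈⟨ +-congˡ (∑<-zero (suc m′) (λ k _ → Σl-zero (seqs n′ m′) (λ κ → supp (k ∷ κ) (inj₁ (s≤s z≤n))))) ⟩
    f [] + 0#                                     ∎
  boxΣ-enlarge {suc n} {suc n′} {m} {m′} f supp (s≤s n≤n′) m≤m′ = begin
    boxΣ (suc n′) m′ f                                  ≈⟨ boxΣ-suc n′ m′ f ⟩
    f [] + ∑< (suc m′) (λ k → boxΣ n′ m′ (f ∘ (k ∷_)))  ≈⟨ +-congˡ (∑<-vanishing-tail _ (s≤s m≤m′) large) ⟩
    f [] + ∑< (suc m) (λ k → boxΣ n′ m′ (f ∘ (k ∷_)))   ≈⟨ +-congˡ (∑<-cong (suc m) (λ k _ →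
                                                              boxΣ-enlarge (f ∘ (k ∷_)) (supp-tail k) n≤n′ m≤m′)) ⟩
    f [] + ∑< (suc m) (λ k → boxΣ n m (f ∘ (k ∷_)))     ≈⟨ sym (boxΣ-suc n m f) ⟩
    boxΣ (suc n) m f                                    ∎
    where
      large : ∀ k → suc m ≤ k → k < suc m′ → boxΣ n′ m′ (f ∘ (k ∷_)) ≈ 0#
      large k m<k _ = Σl-zero (seqs n′ m′) (λ κ → supp (k ∷ κ) (inj₂ (here m<k)))
      supp-tail : ∀ k → SupportedIn n m (f ∘ (k ∷_))
      supp-tail k κ (inj₁ n<|κ|) = supp (k ∷ κ) (inj₁ (s≤s n<|κ|))
      supp-tail k κ (inj₂ m<κ)   = supp (k ∷ κ) (inj₂ (there m<κ))

  ∘ₛ-as-boxΣ : ∀ T R → ZeroConst R → ∀ {n m} w → length w ≤ n → maxLetter w ≤ m →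
               boxΣ n m (λ κ → T κ * σProduct R κ w) ≈ (T ∘ₛ R) w
  ∘ₛ-as-boxΣ T R R₀ w |w|≤n max≤m = boxΣ-enlarge _ supported |w|≤n max≤m
    where
      supported : SupportedIn (length w) (maxLetter w) (λ κ → T κ * σProduct R κ w)
      supported κ (inj₁ |w|<|κ|) = trans (*-congˡ (σProduct-order R R₀ κ w |w|<|κ|)) (zeroʳ _)
      supported κ (inj₂ max<κ)   =
        trans (*-congˡ (σProduct-vanishesBelow R R₀ κ max<κ w ℕ.≤-refl)) (zeroʳ _)

  Σl-splits-cong : ∀ w {f g : Word × Word → Carrier} →
    (∀ u v → length v ≤ length w → maxLetter v ≤ maxLetter w → f (u , v) ≈ g (u , v)) →
    Σl (map f (splits w)) ≈ Σl (map g (splits w))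
  Σl-splits-cong []      f≈g = +-congʳ (f≈g [] [] z≤n z≤n)
  Σl-splits-cong (a ∷ w) {f} {g} f≈g =
    +-cong (f≈g [] (a ∷ w) ℕ.≤-refl ℕ.≤-refl)
           (trans (Σl-map (splits w))
                  (trans (Σl-splits-cong w (λ u v |v|≤ max≤ →
                                 f≈g (a ∷ u) v (ℕ.m≤n⇒m≤1+n |v|≤) (ℕ.m≤n⇒m≤o⊔n a max≤)))
                         (sym (Σl-map (splits w)))))

  boxΣ-*ˢ : ∀ T R → ZeroConst R → ∀ C {n m} w → length w ≤ n → maxLetter w ≤ m →
            boxΣ n m (λ κ → T κ * (C *ˢ σProduct R κ) w) ≈ (C *ˢ (T ∘ₛ R)) w
  boxΣ-*ˢ T R R₀ C {n} {m} w |w|≤n max≤m = begin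
    boxΣ n m (λ κ → T κ * (C *ˢ σProduct R κ) w)
      ≈⟨ Σl-cong (seqs n m) (λ κ → Σl-*ˡ (T κ) (splits w)) ⟩
    Σl (map (λ κ → Σl (map (term κ) (splits w))) (seqs n m))
      ≈⟨ Σl-comm term (seqs n m) (splits w) ⟩
    Σl (map (λ uv → Σl (map (λ κ → term κ uv) (seqs n m))) (splits w))
      ≈⟨ Σl-cong (splits w) (λ (u , v) → factor-out u v) ⟩
    Σl (map (λ (u , v) → C u * boxΣ n m (λ κ → T κ * σProduct R κ v)) (splits w))
      ≈⟨ Σl-splits-cong w (λ u v |v|≤ max≤ →
           *-congˡ (∘ₛ-as-boxΣ T R R₀ v (ℕ.≤-trans |v|≤ |w|≤n) (ℕ.≤-trans max≤ max≤m))) ⟩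
    (C *ˢ (T ∘ₛ R)) w  ∎
    where
      term : Word → Word × Word → Carrier
      term κ (u , v) = T κ * (C u * σProduct R κ v)
      factor-out : ∀ u v → Σl (map (λ κ → term κ (u , v)) (seqs n m))
                           ≈ C u * boxΣ n m (λ κ → T κ * σProduct R κ v)
      factor-out u v = trans (Σl-cong (seqs n m) (λ κ → *-leftComm (T κ) (C u) _))
                             (sym (Σl-*ˡ (C u) (seqs n m)))

  σProduct-∷-∂ : ∀ R → ZeroConst R → ∀ k κ a w →
                 σProduct R (k ∷ κ) (a ∷ w) ≈ (∂ a (σ^ k R) *ˢ σProduct R κ) w
  σProduct-∷-∂ R R₀ k κ a w =
    trans (*ˢ-∷ (σ^ k R) (σProduct R κ) a w)
          (trans (+-congʳ (trans (*-congʳ R₀) (zeroˡ _))) (+-identityˡ _))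

  σ∂ : Ser → ℕ → ℕ → Ser
  σ∂ R a k = σ^ k (∂ (a ∸ k) R)

  σ^-σ∂ : ∀ R a j i → σ^ j (σ∂ R (a ∸ j) i) ≈ˢ σ∂ R a (j +ℕ i)
  σ^-σ∂ R a j i w = trans (σ^-σ^ j i (∂ (a ∸ j ∸ i) R) w)
                          (reflexive (≡.cong (λ b → σ^ (j +ℕ i) (∂ b R) w) (ℕ.∸-+-assoc a j i)))

  -- In the term of κ = k ∷ κ′ the leading letter a must come from the factor σ^k R,
  -- which has zero constant term and only letters ≥ k; summing the remaining factors
  -- over κ′ rebuilds ∂ k T ∘ₛ R.
  ∂-∘ₛ : ∀ T R → ZeroConst R → ∀ a → ∂ a (T ∘ₛ R) ≈ˢ Σˢ (suc a) (λ k → σ∂ R a k *ˢ (∂ k T ∘ₛ R))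
  ∂-∘ₛ T R R₀ a w = begin
    boxΣ (suc n) m F                                ≈⟨ boxΣ-suc n m F ⟩
    F [] + ∑< (suc m) (λ k → boxΣ n m (F ∘ (k ∷_)))  ≈⟨ +-cong (zeroʳ (T [])) (∑<-cong (suc m) (λ k _ → column k)) ⟩
    0# + ∑< (suc m) G                               ≈⟨ +-identityˡ _ ⟩
    ∑< (suc m) G                                    ≈⟨ ∑<-vanishing-tail G (s≤s (ℕ.m≤m⊔n a _)) beyond-a ⟩
    ∑< (suc a) G                                    ≈⟨ ∑<-cong (suc a) (λ k k<1+a →
                                                         *ˢ-congʳ (∂-σ^-≥ k a R (ℕ.≤-pred k<1+a)) w) ⟩
    Σˢ (suc a) (λ k → σ∂ R a k *ˢ (∂ k T ∘ₛ R)) w   ∎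
    where
      n m : ℕ
      n = length w
      m = maxLetter (a ∷ w)
      F : Word → Carrier
      F κ = T κ * σProduct R κ (a ∷ w)
      G : ℕ → Carrier
      G k = (∂ a (σ^ k R) *ˢ (∂ k T ∘ₛ R)) w
      column : ∀ k → boxΣ n m (F ∘ (k ∷_)) ≈ G k
      column k = trans (Σl-cong (seqs n m) (λ κ → *-congˡ (σProduct-∷-∂ R R₀ k κ a w)))
                       (boxΣ-*ˢ (∂ k T) R R₀ (∂ a (σ^ k R)) w ℕ.≤-refl (ℕ.m≤n⊔m a _))
      beyond-a : ∀ k → suc a ≤ k → k < suc m → G k ≈ 0#
      beyond-a k a<k _ = trans (*ˢ-congʳ (∂-σ^-< k a R a<k) w) (*ˢ-zeroˡ _ w)

  ∘ₛ-[] : ∀ T R → (T ∘ₛ R) [] ≈ T []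
  ∘ₛ-[] T R = trans (+-identityʳ _) (*-identityʳ _)

  box : Word → List Word
  box w = seqs (length w) (maxLetter w)

  ∘ₛ-congˡ : ∀ {T T′} R → T ≈ˢ T′ → (T ∘ₛ R) ≈ˢ (T′ ∘ₛ R)
  ∘ₛ-congˡ R T≈ w = Σl-cong (box w) (λ κ → *-congʳ (T≈ κ))

  ∘ₛ-+ˢ : ∀ A B R → ((A +ˢ B) ∘ₛ R) ≈ˢ ((A ∘ₛ R) +ˢ (B ∘ₛ R))
  ∘ₛ-+ˢ A B R w = trans (Σl-cong (box w) (λ κ → distribʳ _ (A κ) (B κ))) (Σl-+ (box w))

  ∘ₛ-·ˢ : ∀ a A R → ((a ·ˢ A) ∘ₛ R) ≈ˢ (a ·ˢ (A ∘ₛ R))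
  ∘ₛ-·ˢ a A R w = trans (Σl-cong (box w) (λ κ → *-assoc a (A κ) _)) (sym (Σl-*ˡ a (box w)))

  ∘ₛ-0ˢ : ∀ R → (0ˢ ∘ₛ R) ≈ˢ 0ˢ
  ∘ₛ-0ˢ R w = Σl-zero (box w) (λ κ → zeroˡ _)

  ∘ₛ-Σˢ : ∀ n F R → (Σˢ n F ∘ₛ R) ≈ˢ Σˢ n (λ k → F k ∘ₛ R)
  ∘ₛ-Σˢ zero    F R = ∘ₛ-0ˢ R
  ∘ₛ-Σˢ (suc n) F R w = trans (∘ₛ-+ˢ (Σˢ n F) (F n) R w) (+-congʳ (∘ₛ-Σˢ n F R w))

  1ˢ-∘ₛ : ∀ R → ZeroConst R → (1ˢ ∘ₛ R) ≈ˢ 1ˢ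
  1ˢ-∘ₛ R R₀ []      = ∘ₛ-[] 1ˢ R
  1ˢ-∘ₛ R R₀ (a ∷ w) = trans (∂-∘ₛ 1ˢ R R₀ a w) (∑<-zero (suc a) (λ k _ →
    trans (*ˢ-congˡ (∘ₛ-0ˢ R) w) (*ˢ-zeroʳ (σ∂ R a k) w)))

  ≈[0] : ∀ {A B} → A [] ≈ B [] → A ≈[ 0 ] B
  ≈[0] A₀≈B₀ [] _ = A₀≈B₀

  ≈[suc]-by-∂ : ∀ n {A B} → A [] ≈ B [] → (∀ a → ∂ a A ≈[ n ] ∂ a B) → A ≈[ suc n ] B
  ≈[suc]-by-∂ n A₀≈B₀ ∂A≈∂B []      _         = A₀≈B₀
  ≈[suc]-by-∂ n A₀≈B₀ ∂A≈∂B (a ∷ w) (s≤s w≤n) = ∂A≈∂B a w w≤n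

  ∂₀-X₀ : ∂ 0 X₀ ≈ˢ 1ˢ
  ∂₀-X₀ []      = refl
  ∂₀-X₀ (_ ∷ _) = refl

  σ∂-X₀-< : ∀ {a k} → k < a → σ∂ X₀ a k ≈ˢ 0ˢ
  σ∂-X₀-< {a} {k} k<a = ≈ˢ-trans (σ^-cong k (∂-X₀-pos (a ∸ k) (ℕ.m<n⇒0<n∸m k<a))) (σ^-0ˢ k)
    where ∂-X₀-pos : ∀ b → 0 < b → ∂ b X₀ ≈ˢ 0ˢ
          ∂-X₀-pos (suc b) _ _ = refl

  σ∂-X₀-diagonal : ∀ a → σ∂ X₀ a a ≈ˢ 1ˢ
  σ∂-X₀-diagonal a = ≈ˢ-trans (σ^-cong a ∂₀-X₀′) (σ^-1ˢ a)
    where ∂₀-X₀′ : ∂ (a ∸ a) X₀ ≈ˢ 1ˢ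
          ∂₀-X₀′ rewrite ℕ.n∸n≡0 a = ∂₀-X₀

  -- Composition with a fixed series

  module _ (R : Ser) (R₀ : ZeroConst R) where

    ∂-∘ₛ-*ˢ : ∀ a A B → ∂ a ((A *ˢ B) ∘ₛ R) ≈ˢ
      Σˢ (suc a) (λ k → σ∂ R a k *ˢ ((A [] ·ˢ (∂ k B ∘ₛ R)) +ˢ ((∂ k A *ˢ B) ∘ₛ R)))
    ∂-∘ₛ-*ˢ a A B = ≈ˢ-trans (∂-∘ₛ (A *ˢ B) R R₀ a) (Σˢ-cong (suc a) (λ k _ → *ˢ-congˡ
      (≈ˢ-trans (∘ₛ-congˡ R (∂-*ˢ k A B))
      (≈ˢ-trans (∘ₛ-+ˢ _ _ R) (λ w → +-congʳ (∘ₛ-·ˢ (A []) (∂ k B) R w))))))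

    ∂-*ˢ-∘ₛ : ∀ a A B → ∂ a ((A ∘ₛ R) *ˢ (B ∘ₛ R)) ≈ˢ
      Σˢ (suc a) (λ k → σ∂ R a k *ˢ ((A [] ·ˢ (∂ k B ∘ₛ R)) +ˢ ((∂ k A ∘ₛ R) *ˢ (B ∘ₛ R))))
    ∂-*ˢ-∘ₛ a A B w = begin
      ∂ a ((A ∘ₛ R) *ˢ (B ∘ₛ R)) w
        ≈⟨ ∂-*ˢ a (A ∘ₛ R) (B ∘ₛ R) w ⟩
      (A ∘ₛ R) [] * ∂ a (B ∘ₛ R) w + (∂ a (A ∘ₛ R) *ˢ (B ∘ₛ R)) w
        ≈⟨ +-cong (*-cong (∘ₛ-[] A R) (∂-∘ₛ B R R₀ a w)) (*ˢ-congʳ (∂-∘ₛ A R R₀ a) w) ⟩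
      A [] * Σˢ (suc a) termB w + (Σˢ (suc a) termA *ˢ (B ∘ₛ R)) w
        ≈⟨ +-cong (sym (Σˢ-·ˢ (suc a) (A []) termB w)) (*ˢ-Σˢʳ (suc a) termA (B ∘ₛ R) w) ⟩
      Σˢ (suc a) (λ k → A [] ·ˢ termB k) w + Σˢ (suc a) (λ k → termA k *ˢ (B ∘ₛ R)) w
        ≈⟨ sym (Σˢ-+ (suc a) (λ k → A [] ·ˢ termB k) (λ k → termA k *ˢ (B ∘ₛ R)) w) ⟩
      Σˢ (suc a) (λ k → A [] ·ˢ termB k +ˢ termA k *ˢ (B ∘ₛ R)) w
        ≈⟨ Σˢ-cong (suc a) {G = λ k → σ∂ R a k *ˢ ((A [] ·ˢ (∂ k B ∘ₛ R)) +ˢ ((∂ k A ∘ₛ R) *ˢ (B ∘ₛ R)))}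
             (λ k _ v → sym (trans (*ˢ-distribˡ (σ∂ R a k) _ _ v)
               (+-cong (*ˢ-·ˢʳ (A []) (σ∂ R a k) _ v) (sym (*ˢ-assoc (σ∂ R a k) _ _ v))))) w ⟩
      Σˢ (suc a) (λ k → σ∂ R a k *ˢ ((A [] ·ˢ (∂ k B ∘ₛ R)) +ˢ ((∂ k A ∘ₛ R) *ˢ (B ∘ₛ R)))) w  ∎
      where
        termA termB : ℕ → Ser
        termA k = σ∂ R a k *ˢ (∂ k A ∘ₛ R)
        termB k = σ∂ R a k *ˢ (∂ k B ∘ₛ R)

    ∘ₛ-*ˢ-[] : ∀ A B → ((A *ˢ B) ∘ₛ R) [] ≈ ((A ∘ₛ R) *ˢ (B ∘ₛ R)) []
    ∘ₛ-*ˢ-[] A B = trans (∘ₛ-[] (A *ˢ B) R) (trans (*ˢ-[] A B)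
      (sym (trans (*ˢ-[] (A ∘ₛ R) (B ∘ₛ R)) (*-cong (∘ₛ-[] A R) (∘ₛ-[] B R)))))

    ∘ₛ-*ˢ≤ : ∀ n A B → ((A *ˢ B) ∘ₛ R) ≈[ n ] ((A ∘ₛ R) *ˢ (B ∘ₛ R))
    ∘ₛ-*ˢ≤ zero    A B = ≈[0] (∘ₛ-*ˢ-[] A B)
    ∘ₛ-*ˢ≤ (suc n) A B = ≈[suc]-by-∂ n (∘ₛ-*ˢ-[] A B) (λ a →
      ≈[]-by-≈ˢ (∂-∘ₛ-*ˢ a A B)
                (Σˢ-cong≤ n (suc a) (λ k _ → *ˢ-cong≤ n (λ _ _ → refl) (λ w w≤n →
                   +-congˡ (∘ₛ-*ˢ≤ n (∂ k A) B w w≤n))))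
                (∂-*ˢ-∘ₛ a A B))

    ∘ₛ-*ˢ : ∀ A B → ((A *ˢ B) ∘ₛ R) ≈ˢ ((A ∘ₛ R) *ˢ (B ∘ₛ R))
    ∘ₛ-*ˢ A B = ≈[]⇒≈ˢ (λ n → ∘ₛ-*ˢ≤ n A B)

    σ∂-∘ₛ : ∀ T a j → σ∂ (T ∘ₛ R) a j ≈ˢ Σˢ (suc (a ∸ j)) (λ i → σ∂ R a (j +ℕ i) *ˢ σ^ j (∂ i T ∘ₛ R))
    σ∂-∘ₛ T a j w = begin
      σ^ j (∂ (a ∸ j) (T ∘ₛ R)) w
        ≈⟨ σ^-cong j (∂-∘ₛ T R R₀ (a ∸ j)) w ⟩
      σ^ j (Σˢ (suc (a ∸ j)) (λ i → σ∂ R (a ∸ j) i *ˢ (∂ i T ∘ₛ R))) w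
        ≈⟨ σ^-Σˢ j (suc (a ∸ j)) term w ⟩
      Σˢ (suc (a ∸ j)) (λ i → σ^ j (term i)) w
        ≈⟨ Σˢ-cong (suc (a ∸ j)) (λ i _ v →
             trans (σ^-*ˢ j (σ∂ R (a ∸ j) i) (∂ i T ∘ₛ R) v) (*ˢ-congʳ (σ^-σ∂ R a j i) v)) w ⟩
      Σˢ (suc (a ∸ j)) (λ i → σ∂ R a (j +ℕ i) *ˢ σ^ j (∂ i T ∘ₛ R)) w  ∎
      where
        term : ℕ → Ser
        term i = σ∂ R (a ∸ j) i *ˢ (∂ i T ∘ₛ R)

    ∂-σ^-∘ₛ : ∀ j a A → j ≤ a →
      ∂ a (σ^ j A ∘ₛ R) ≈ˢ Σˢ (suc (a ∸ j)) (λ i → σ∂ R a (j +ℕ i) *ˢ (σ^ j (∂ i A) ∘ₛ R))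
    ∂-σ^-∘ₛ j a A j≤a w = begin
      ∂ a (σ^ j A ∘ₛ R) w
        ≈⟨ ∂-∘ₛ (σ^ j A) R R₀ a w ⟩
      ∑< (suc a) (λ k → G k w)
        ≡⟨ ≡.cong (λ n → ∑< n (λ k → G k w)) (≡.sym j+[1+a∸j]≡1+a) ⟩
      ∑< (j +ℕ suc (a ∸ j)) (λ k → G k w)
        ≈⟨ ∑<-vanishing-head j (suc (a ∸ j)) (λ k → G k w) (λ k k<j → below-j k k<j w) ⟩
      ∑< (suc (a ∸ j)) (λ i → G (j +ℕ i) w)
        ≈⟨ ∑<-cong (suc (a ∸ j)) (λ i _ → *ˢ-congˡ (∘ₛ-congˡ R (∂-σ^-shift i)) w) ⟩
      Σˢ (suc (a ∸ j)) (λ i → σ∂ R a (j +ℕ i) *ˢ (σ^ j (∂ i A) ∘ₛ R)) w  ∎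
      where
        G : ℕ → Ser
        G k = σ∂ R a k *ˢ (∂ k (σ^ j A) ∘ₛ R)
        j+[1+a∸j]≡1+a : j +ℕ suc (a ∸ j) ≡ suc a
        j+[1+a∸j]≡1+a = ≡.trans (ℕ.+-suc j (a ∸ j)) (≡.cong suc (ℕ.m+[n∸m]≡n j≤a))
        below-j : ∀ k → k < j → G k ≈ˢ 0ˢ
        below-j k k<j = ≈ˢ-trans (*ˢ-congˡ (≈ˢ-trans (∘ₛ-congˡ R (∂-σ^-< j k A k<j)) (∘ₛ-0ˢ R)))
                                 (*ˢ-zeroʳ _)
        ∂-σ^-shift : ∀ i → ∂ (j +ℕ i) (σ^ j A) ≈ˢ σ^ j (∂ i A)
        ∂-σ^-shift i v = trans (∂-σ^-≥ j (j +ℕ i) A (ℕ.m≤m+n j i) v)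
                               (reflexive (≡.cong (λ b → σ^ j (∂ b A) v) (ℕ.m+n∸m≡n j i)))

    ∘ₛ-σ^-[] : ∀ j A → (σ^ j A ∘ₛ R) [] ≈ σ^ j (A ∘ₛ R) []
    ∘ₛ-σ^-[] j A = trans (∘ₛ-[] (σ^ j A) R) (sym (∘ₛ-[] A R))

    ∘ₛ-σ^≤ : ∀ n j A → (σ^ j A ∘ₛ R) ≈[ n ] σ^ j (A ∘ₛ R)
    ∘ₛ-σ^≤ zero    j A = ≈[0] (∘ₛ-σ^-[] j A)
    ∘ₛ-σ^≤ (suc n) j A = ≈[suc]-by-∂ n (∘ₛ-σ^-[] j A) step
      where
        step : ∀ a → ∂ a (σ^ j A ∘ₛ R) ≈[ n ] ∂ a (σ^ j (A ∘ₛ R))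
        step a with j ℕ.≤? a
        ... | yes j≤a = ≈[]-by-≈ˢ (∂-σ^-∘ₛ j a A j≤a)
                          (Σˢ-cong≤ n (suc (a ∸ j)) (λ i _ →
                             *ˢ-cong≤ n (λ _ _ → refl) (∘ₛ-σ^≤ n j (∂ i A))))
                          (≈ˢ-trans (∂-σ^-≥ j a (A ∘ₛ R) j≤a) (σ∂-∘ₛ A a j))
        ... | no j≰a = ≈ˢ⇒≈[] (≈ˢ-trans (∂-∘ₛ (σ^ j A) R R₀ a)
                          (≈ˢ-trans (Σˢ-zero (suc a) _ vanish) (≈ˢ-sym (∂-σ^-< j a (A ∘ₛ R) a<j))))
          where
            a<j = ℕ.≰⇒> j≰a
            vanish : ∀ k → k < suc a → (σ∂ R a k *ˢ (∂ k (σ^ j A) ∘ₛ R)) ≈ˢ 0ˢ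
            vanish k k≤a = ≈ˢ-trans (*ˢ-congˡ (≈ˢ-trans (∘ₛ-congˡ R (∂-σ^-< j k A (ℕ.<-≤-trans k≤a a<j)))
                                                         (∘ₛ-0ˢ R)))
                                    (*ˢ-zeroʳ _)

    ∘ₛ-σ^ : ∀ j A → (σ^ j A ∘ₛ R) ≈ˢ σ^ j (A ∘ₛ R)
    ∘ₛ-σ^ j A = ≈[]⇒≈ˢ (λ n → ∘ₛ-σ^≤ n j A)

    X₀-∘ₛ : (X₀ ∘ₛ R) ≈ˢ R
    X₀-∘ₛ []      = trans (∘ₛ-[] X₀ R) (sym R₀)
    X₀-∘ₛ (a ∷ w) = begin
      ∂ a (X₀ ∘ₛ R) w                                       ≈⟨ ∂-∘ₛ X₀ R R₀ a w ⟩
      Σˢ (suc a) G w                                        ≈⟨ ∑<-suc a (λ k → G k w) ⟩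
      G 0 w + ∑< a (λ k → G (suc k) w)                      ≈⟨ +-congˡ (∑<-zero a (λ k _ →
                                                                 trans (*ˢ-congˡ (∘ₛ-0ˢ R) w) (*ˢ-zeroʳ _ w))) ⟩
      G 0 w + 0#                                            ≈⟨ +-identityʳ _ ⟩
      (σ^ 0 (∂ a R) *ˢ (∂ 0 X₀ ∘ₛ R)) w                     ≈⟨ *ˢ-cong (σ^-identity (∂ a R))
                                                                 (≈ˢ-trans (∘ₛ-congˡ R ∂₀-X₀) (1ˢ-∘ₛ R R₀)) w ⟩
      (∂ a R *ˢ 1ˢ) w                                       ≈⟨ *ˢ-identityʳ (∂ a R) w ⟩
      ∂ a R w                                               ∎
      where
        G : ℕ → Ser
        G k = σ∂ R a k *ˢ (∂ k X₀ ∘ₛ R)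

  ∂-∘ₛ-X₀ : ∀ a U → ∂ a (U ∘ₛ X₀) ≈ˢ (∂ a U ∘ₛ X₀)
  ∂-∘ₛ-X₀ a U w = begin
    ∂ a (U ∘ₛ X₀) w                       ≈⟨ ∂-∘ₛ U X₀ refl a w ⟩
    ∑< a (λ k → G k w) + G a w            ≈⟨ +-congʳ (∑<-zero a (λ k k<a →
                                               trans (*ˢ-congʳ (σ∂-X₀-< k<a) w) (*ˢ-zeroˡ _ w))) ⟩
    0# + G a w                            ≈⟨ +-identityˡ _ ⟩
    (σ∂ X₀ a a *ˢ (∂ a U ∘ₛ X₀)) w        ≈⟨ *ˢ-congʳ (σ∂-X₀-diagonal a) w ⟩
    (1ˢ *ˢ (∂ a U ∘ₛ X₀)) w               ≈⟨ *ˢ-identityˡ _ w ⟩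
    (∂ a U ∘ₛ X₀) w                       ∎
    where
      G : ℕ → Ser
      G k = σ∂ X₀ a k *ˢ (∂ k U ∘ₛ X₀)

  ∘ₛ-X₀≤ : ∀ n U → (U ∘ₛ X₀) ≈[ n ] U
  ∘ₛ-X₀≤ zero    U = ≈[0] (∘ₛ-[] U X₀)
  ∘ₛ-X₀≤ (suc n) U = ≈[suc]-by-∂ n (∘ₛ-[] U X₀) (λ a →
    ≈[]-by-≈ˢ (∂-∘ₛ-X₀ a U) (∘ₛ-X₀≤ n (∂ a U)) (λ _ → refl))

  ∘ₛ-X₀ : ∀ U → (U ∘ₛ X₀) ≈ˢ U
  ∘ₛ-X₀ U = ≈[]⇒≈ˢ (λ n → ∘ₛ-X₀≤ n U)

  ∘ₛ-congʳ≤ : ∀ {S S′} → ZeroConst S → ZeroConst S′ → S ≈ˢ S′ → ∀ n U → (U ∘ₛ S) ≈[ n ] (U ∘ₛ S′)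
  ∘ₛ-congʳ≤ {S} {S′} S₀ S′₀ S≈S′ zero    U = ≈[0] (trans (∘ₛ-[] U S) (sym (∘ₛ-[] U S′)))
  ∘ₛ-congʳ≤ {S} {S′} S₀ S′₀ S≈S′ (suc n) U =
    ≈[suc]-by-∂ n (trans (∘ₛ-[] U S) (sym (∘ₛ-[] U S′))) (λ a →
      ≈[]-by-≈ˢ (∂-∘ₛ U S S₀ a)
                (Σˢ-cong≤ n (suc a) (λ k _ →
                   *ˢ-cong≤ n (≈ˢ⇒≈[] (σ^-cong k (λ w → S≈S′ (a ∸ k ∷ w))))
                              (∘ₛ-congʳ≤ S₀ S′₀ S≈S′ n (∂ k U))))
                (∂-∘ₛ U S′ S′₀ a))

  ∘ₛ-congʳ : ∀ {S S′} → ZeroConst S → ZeroConst S′ → S ≈ˢ S′ → ∀ U → (U ∘ₛ S) ≈ˢ (U ∘ₛ S′)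
  ∘ₛ-congʳ S₀ S′₀ S≈S′ U = ≈[]⇒≈ˢ (λ n → ∘ₛ-congʳ≤ S₀ S′₀ S≈S′ n U)

  module _ (T R : Ser) (T₀ : ZeroConst T) (R₀ : ZeroConst R) where

    ∂-∘ₛ-∘ₛ : ∀ k U → (∂ k (U ∘ₛ T) ∘ₛ R) ≈ˢ
      Σˢ (suc k) (λ j → σ^ j (∂ (k ∸ j) T ∘ₛ R) *ˢ ((∂ j U ∘ₛ T) ∘ₛ R))
    ∂-∘ₛ-∘ₛ k U w = begin
      (∂ k (U ∘ₛ T) ∘ₛ R) w
        ≈⟨ ∘ₛ-congˡ R (∂-∘ₛ U T T₀ k) w ⟩
      (Σˢ (suc k) (λ j → σ∂ T k j *ˢ (∂ j U ∘ₛ T)) ∘ₛ R) w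
        ≈⟨ ∘ₛ-Σˢ (suc k) (λ j → σ∂ T k j *ˢ (∂ j U ∘ₛ T)) R w ⟩
      Σˢ (suc k) (λ j → (σ∂ T k j *ˢ (∂ j U ∘ₛ T)) ∘ₛ R) w
        ≈⟨ Σˢ-cong (suc k) (λ j _ → ≈ˢ-trans (∘ₛ-*ˢ R R₀ (σ∂ T k j) (∂ j U ∘ₛ T))
                                              (*ˢ-congʳ (∘ₛ-σ^ R R₀ j (∂ (k ∸ j) T)))) w ⟩
      Σˢ (suc k) (λ j → σ^ j (∂ (k ∸ j) T ∘ₛ R) *ˢ ((∂ j U ∘ₛ T) ∘ₛ R)) w  ∎

    Σˢ-triangle-∘ₛ : ∀ a (V : ℕ → Ser) →
      Σˢ (suc a) (λ k → σ∂ R a k *ˢ Σˢ (suc k) (λ j → σ^ j (∂ (k ∸ j) T ∘ₛ R) *ˢ V j))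
        ≈ˢ Σˢ (suc a) (λ j → σ∂ (T ∘ₛ R) a j *ˢ V j)
    Σˢ-triangle-∘ₛ a V w = begin
      Σˢ (suc a) (λ k → σ∂ R a k *ˢ Σˢ (suc k) (λ j → σ^ j (∂ (k ∸ j) T ∘ₛ R) *ˢ V j)) w
        ≈⟨ Σˢ-cong (suc a) {G = λ k → Σˢ (suc k) (f k)} (λ k _ v →
             trans (*ˢ-Σˢˡ (suc k) (g k) (σ∂ R a k) v)
                   (Σˢ-cong (suc k) {G = f k} (λ j _ →
                      ≈ˢ-sym (*ˢ-assoc (σ∂ R a k) (σ^ j (∂ (k ∸ j) T ∘ₛ R)) (V j))) v)) w ⟩
      ∑< (suc a) (λ k → ∑< (suc k) (λ j → f k j w))
        ≈⟨ ∑<-triangle (suc a) (λ k j → f k j w) ⟩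
      ∑< (suc a) (λ j → ∑< (suc a ∸ j) (λ i → f (j +ℕ i) j w))
        ≈⟨ ∑<-cong (suc a) (λ j j<1+a → trans
             (reflexive (≡.cong (λ n → ∑< n (λ i → f (j +ℕ i) j w)) (ℕ.+-∸-assoc 1 (ℕ.≤-pred j<1+a))))
             (∑<-cong (suc (a ∸ j)) (λ i _ → *ˢ-congʳ (*ˢ-congˡ (σ^-cong j (∘ₛ-congˡ R
                (λ v → reflexive (≡.cong (λ b → ∂ b T v) (ℕ.m+n∸m≡n j i)))))) w))) ⟩
      ∑< (suc a) (λ j → Σˢ (suc (a ∸ j)) (λ i → (σ∂ R a (j +ℕ i) *ˢ σ^ j (∂ i T ∘ₛ R)) *ˢ V j) w)
        ≈⟨ ∑<-cong (suc a) (λ j _ → sym (trans (*ˢ-congʳ (σ∂-∘ₛ R R₀ T a j) w)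
             (*ˢ-Σˢʳ (suc (a ∸ j)) (λ i → σ∂ R a (j +ℕ i) *ˢ σ^ j (∂ i T ∘ₛ R)) (V j) w))) ⟩
      Σˢ (suc a) (λ j → σ∂ (T ∘ₛ R) a j *ˢ V j) w  ∎
      where
        g f : ℕ → ℕ → Ser
        g k j = σ^ j (∂ (k ∸ j) T ∘ₛ R) *ˢ V j
        f k j = (σ∂ R a k *ˢ σ^ j (∂ (k ∸ j) T ∘ₛ R)) *ˢ V j

    ∘ₛ-assoc-[] : ∀ U → ((U ∘ₛ T) ∘ₛ R) [] ≈ (U ∘ₛ (T ∘ₛ R)) []
    ∘ₛ-assoc-[] U = trans (∘ₛ-[] (U ∘ₛ T) R) (trans (∘ₛ-[] U T) (sym (∘ₛ-[] U (T ∘ₛ R))))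

    ∘ₛ-assoc≤ : ∀ n U → ((U ∘ₛ T) ∘ₛ R) ≈[ n ] (U ∘ₛ (T ∘ₛ R))
    ∘ₛ-assoc≤ zero    U = ≈[0] (∘ₛ-assoc-[] U)
    ∘ₛ-assoc≤ (suc n) U = ≈[suc]-by-∂ n (∘ₛ-assoc-[] U) (λ a →
      ≈[]-by-≈ˢ (≈ˢ-trans (∂-∘ₛ (U ∘ₛ T) R R₀ a) (Σˢ-cong (suc a) (λ k _ → *ˢ-congˡ (∂-∘ₛ-∘ₛ k U))))
                (Σˢ-cong≤ n (suc a) (λ k _ → *ˢ-cong≤ n (λ _ _ → refl) (Σˢ-cong≤ n (suc k) (λ j _ →
                   *ˢ-cong≤ n (λ _ _ → refl) (∘ₛ-assoc≤ n (∂ j U))))))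
                (≈ˢ-trans (∂-∘ₛ U (T ∘ₛ R) TR₀ a) (≈ˢ-sym (Σˢ-triangle-∘ₛ a (λ j → ∂ j U ∘ₛ (T ∘ₛ R))))))
      where TR₀ : ZeroConst (T ∘ₛ R)
            TR₀ = trans (∘ₛ-[] T R) T₀

    ∘ₛ-assoc : ∀ U → ((U ∘ₛ T) ∘ₛ R) ≈ˢ (U ∘ₛ (T ∘ₛ R))
    ∘ₛ-assoc U = ≈[]⇒≈ˢ (λ n → ∘ₛ-assoc≤ n U)

  -- Division of series

  module _ (B : Ser) (b⁻¹ : Carrier) (b⁻¹-inv : B [] * b⁻¹ ≈ 1#) where

    -- The fuel only bounds the recursion; it suffices when it is at least the length
    -- of the word (divideFuel-mono), and the clause for fuel zero is junk.
    divideFuel : ℕ → Ser → Ser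
    divideFuel f       G []      = b⁻¹ * G []
    divideFuel zero    G (_ ∷ _) = 0#
    divideFuel (suc f) G (x ∷ w) = b⁻¹ * (G (x ∷ w) - (∂ x B *ˢ divideFuel f G) w)

    divide : Ser → Ser
    divide G w = divideFuel (length w) G w

    divideFuel-mono : ∀ G {f f′} → f ≤ f′ → divideFuel f G ≈[ f ] divideFuel f′ G
    divideFuel-mono G f≤f′ [] _ = refl
    divideFuel-mono G {suc f} {suc f′} (s≤s f≤f′) (x ∷ w) (s≤s |w|≤f) =
      *-congˡ (+-congˡ (-‿cong (*ˢ-cong≤ f (λ _ _ → refl) (divideFuel-mono G f≤f′) w |w|≤f)))

    divideFuel-cong : ∀ {G G′} → G ≈ˢ G′ → ∀ f → divideFuel f G ≈ˢ divideFuel f G′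
    divideFuel-cong G≈G′ f       []      = *-congˡ (G≈G′ [])
    divideFuel-cong G≈G′ zero    (x ∷ w) = refl
    divideFuel-cong G≈G′ (suc f) (x ∷ w) =
      *-congˡ (+-cong (G≈G′ (x ∷ w)) (-‿cong (*ˢ-congˡ (divideFuel-cong G≈G′ f) w)))

    divide-cong : ∀ {G G′} → G ≈ˢ G′ → divide G ≈ˢ divide G′
    divide-cong G≈G′ w = divideFuel-cong G≈G′ (length w) w

    b-cancel : ∀ x → B [] * (b⁻¹ * x) ≈ x
    b-cancel x = trans (sym (*-assoc (B []) b⁻¹ x)) (trans (*-congʳ b⁻¹-inv) (*-identityˡ x))

    *ˢ-divide : ∀ G → (B *ˢ divide G) ≈ˢ G
    *ˢ-divide G []      = trans (*ˢ-[] B (divide G)) (b-cancel (G []))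
    *ˢ-divide G (x ∷ w) = begin
      (B *ˢ divide G) (x ∷ w)
        ≈⟨ *ˢ-∷ B (divide G) x w ⟩
      B [] * divide G (x ∷ w) + (∂ x B *ˢ divide G) w
        ≈⟨ +-cong (b-cancel _) (*ˢ-cong≤ (length w) (λ _ _ → refl) enough-fuel w ℕ.≤-refl) ⟩
      (G (x ∷ w) - (∂ x B *ˢ divideFuel (length w) G) w) + (∂ x B *ˢ divideFuel (length w) G) w
        ≈⟨ //-rightDividesˡ _ (G (x ∷ w)) ⟩
      G (x ∷ w)  ∎
      where enough-fuel : divide G ≈[ length w ] divideFuel (length w) G
            enough-fuel v |v|≤ = divideFuel-mono G |v|≤ v ℕ.≤-refl

  -- Left inverses

  module _ (R : Ser) (R₀ : ZeroConst R) (α⁻¹ : Carrier) (α⁻¹-inv : R (0 ∷ []) * α⁻¹ ≈ 1#) where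

    pivot : ℕ → Ser
    pivot a = σ^ a (∂ 0 R)

    σ∂-diagonal : ∀ a → σ∂ R a a ≈ˢ pivot a
    σ∂-diagonal a w = reflexive (≡.cong (λ b → σ^ a (∂ b R) w) (ℕ.n∸n≡0 a))

    nextSolution : Ser → ℕ → (ℕ → Ser) → Ser
    nextSolution Y a Z = divide (pivot a) α⁻¹ α⁻¹-inv (∂ a Y -ˢ Σˢ a (λ k → σ∂ R a k *ˢ Z k))

    -- solutionsUpTo Y a k is the k-th unknown of the triangular system
    -- Σ_{k ≤ a} σ∂ R a k · Z k = ∂ a Y when k ≤ a, and junk otherwise.
    solutionsUpTo : Ser → ℕ → ℕ → Ser
    solutionsUpTo Y zero    k = nextSolution Y 0 (λ _ → 0ˢ)
    solutionsUpTo Y (suc a) k =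
      if k ≤ᵇ a then solutionsUpTo Y a k else nextSolution Y (suc a) (solutionsUpTo Y a)

    solution : Ser → ℕ → Ser
    solution Y a = solutionsUpTo Y a a

    solutionsUpTo-stable : ∀ Y {a k} → k ≤ a → solutionsUpTo Y a k ≡ solution Y k
    solutionsUpTo-stable Y {zero}  z≤n = ≡.refl
    solutionsUpTo-stable Y {suc a} {k} k≤1+a with k ℕ.≤? a
    ... | yes k≤a rewrite ≤⇒≤ᵇ≡true k≤a = solutionsUpTo-stable Y k≤a
    ... | no  k≰a with ℕ.≤-antisym k≤1+a (ℕ.≰⇒> k≰a)
    ...   | ≡.refl = ≡.refl

    solution-unfold : ∀ Y a → solution Y a ≈ˢ nextSolution Y a (solution Y)
    solution-unfold Y zero    w = refl
    solution-unfold Y (suc a) w rewrite >⇒≤ᵇ≡false (ℕ.n<1+n a) =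
      divide-cong (pivot (suc a)) α⁻¹ α⁻¹-inv (λ v → +-congˡ (-‿cong (∑<-cong (suc a) (λ k k<1+a →
        *ˢ-congˡ (λ u → reflexive (≡.cong (λ Z → Z u) (solutionsUpTo-stable Y (ℕ.≤-pred k<1+a)))) v)))) w

    solution-solves : ∀ Y a → Σˢ (suc a) (λ k → σ∂ R a k *ˢ solution Y k) ≈ˢ ∂ a Y
    solution-solves Y a w = begin
      Σˢ a (λ k → σ∂ R a k *ˢ solution Y k) w + (σ∂ R a a *ˢ solution Y a) w
        ≈⟨ +-congˡ (*ˢ-cong (σ∂-diagonal a) (solution-unfold Y a) w) ⟩
      Σˢ a (λ k → σ∂ R a k *ˢ solution Y k) w + (pivot a *ˢ nextSolution Y a (solution Y)) w
        ≈⟨ +-congˡ (*ˢ-divide (pivot a) α⁻¹ α⁻¹-inv _ w) ⟩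
      Σˢ a (λ k → σ∂ R a k *ˢ solution Y k) w + (∂ a Y w - Σˢ a (λ k → σ∂ R a k *ˢ solution Y k) w)
        ≈⟨ +-comm _ _ ⟩
      (∂ a Y w - Σˢ a (λ k → σ∂ R a k *ˢ solution Y k) w) + Σˢ a (λ k → σ∂ R a k *ˢ solution Y k) w
        ≈⟨ //-rightDividesˡ _ (∂ a Y w) ⟩
      ∂ a Y w  ∎

    -- ∂ k (preimage Y) is preimage (solution Y k), so by the chain rule
    -- preimage Y ∘ₛ R ≈ Y reduces to the triangular system.
    preimage : Ser → Ser
    preimage Y []      = Y []
    preimage Y (a ∷ κ) = preimage (solution Y a) κ

    preimage-∘ₛ≤ : ∀ n Y → (preimage Y ∘ₛ R) ≈[ n ] Y
    preimage-∘ₛ≤ zero    Y = ≈[0] (∘ₛ-[] (preimage Y) R)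
    preimage-∘ₛ≤ (suc n) Y = ≈[suc]-by-∂ n (∘ₛ-[] (preimage Y) R) (λ a →
      ≈[]-by-≈ˢ (∂-∘ₛ (preimage Y) R R₀ a)
                (Σˢ-cong≤ n (suc a) (λ k _ →
                   *ˢ-cong≤ n (λ _ _ → refl) (preimage-∘ₛ≤ n (solution Y k))))
                (≈ˢ-sym (solution-solves Y a)))

    preimage-∘ₛ : ∀ Y → (preimage Y ∘ₛ R) ≈ˢ Y
    preimage-∘ₛ Y = ≈[]⇒≈ˢ (λ n → preimage-∘ₛ≤ n Y)

    preimage-linear : ∀ Y → preimage Y (0 ∷ []) ≈ α⁻¹ * Y (0 ∷ [])
    preimage-linear Y = *-congˡ (trans (+-congˡ ε⁻¹≈ε) (+-identityʳ _))

  left-inverse-of-left-inverse : ∀ {R T U} → ZeroConst R → ZeroConst T →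
    (T ∘ₛ R) ≈ˢ X₀ → (U ∘ₛ T) ≈ˢ X₀ → R ≈ˢ U
  left-inverse-of-left-inverse {R} {T} {U} R₀ T₀ T∘R≈X₀ U∘T≈X₀ w = begin
    R w                     ≈⟨ X₀-∘ₛ R R₀ w ⟨
    (X₀ ∘ₛ R) w             ≈⟨ ∘ₛ-congˡ R U∘T≈X₀ w ⟨
    ((U ∘ₛ T) ∘ₛ R) w       ≈⟨ ∘ₛ-assoc T R T₀ R₀ U w ⟩
    (U ∘ₛ (T ∘ₛ R)) w       ≈⟨ ∘ₛ-congʳ (trans (∘ₛ-[] T R) T₀) refl T∘R≈X₀ U w ⟩
    (U ∘ₛ X₀) w             ≈⟨ ∘ₛ-X₀ U w ⟩
    U w                     ∎

  shift-plethystic-inverse : ∀ R → ZeroConst R → Σ Carrier (λ α⁻¹ → R (0 ∷ []) * α⁻¹ ≈ 1#) →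
    Σ Ser (λ R⁻¹ → ZeroConst R⁻¹ × ((R ∘ₛ R⁻¹) ≈ˢ X₀) × ((R⁻¹ ∘ₛ R) ≈ˢ X₀))
  shift-plethystic-inverse R R₀ (α⁻¹ , α⁻¹-inv) = T , refl , R∘T≈X₀ , T∘R≈X₀
    where
      T : Ser
      T = preimage R R₀ α⁻¹ α⁻¹-inv X₀
      T∘R≈X₀ : (T ∘ₛ R) ≈ˢ X₀
      T∘R≈X₀ = preimage-∘ₛ R R₀ α⁻¹ α⁻¹-inv X₀
      T-linear-inv : T (0 ∷ []) * R (0 ∷ []) ≈ 1#
      T-linear-inv = trans (*-congʳ (trans (preimage-linear R R₀ α⁻¹ α⁻¹-inv X₀) (*-identityʳ α⁻¹)))
                           (trans (*-comm α⁻¹ _) α⁻¹-inv)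
      U : Ser
      U = preimage T refl (R (0 ∷ [])) T-linear-inv X₀
      U∘T≈X₀ : (U ∘ₛ T) ≈ˢ X₀
      U∘T≈X₀ = preimage-∘ₛ T refl (R (0 ∷ [])) T-linear-inv X₀
      R∘T≈X₀ : (R ∘ₛ T) ≈ˢ X₀
      R∘T≈X₀ = ≈ˢ-trans (∘ₛ-congˡ T (left-inverse-of-left-inverse R₀ refl T∘R≈X₀ U∘T≈X₀)) U∘T≈X₀

mainTheorem10 : ∀ {c ℓ} (K : CommutativeRing c ℓ) → IsField K → CharZero K →
    let open CommutativeRing K in let open Series K in
    (R : Ser) → ZeroConst R → ¬ (R (0 ∷ []) ≈ 0#) →
    Σ Ser (λ Rinv → ZeroConst Rinv × ((R ∘ₛ Rinv) ≈ˢ X₀) × ((Rinv ∘ₛ R) ≈ˢ X₀))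
mainTheorem10 K K-field _ R R₀ α≉0 =
  Plethysm.shift-plethystic-inverse K R R₀ (IsField.inverse K-field (R (0 ∷ [])) α≉0)
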